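{- Let $\sigma$ be a partition of a positive integer $r$ with smallest part $\delta$, let $n,q$ be positive integers, let $H=H(n,r,q\mid\sigma)$, and let $\beta$ be an integer with $2 \le s(\sigma)\le\beta$ and $\delta \geq r-\beta + 1$. Suppose we are given a $(2,\beta)$-colouring of $H$, let $V$ be a class of $H$, and let $z$ be a colour not used in the given colouring. If the colour of every vertex of $V$ is changed to $z$ (all other vertices keeping their colours), then the resulting colouring of $H$ is a $(2,\beta)$-colouring.
   Context: For a partition $\sigma$ of $r$ and positive integers $n,q$, the $\sigma$-hypergraph $H(n,r,q\mid\sigma)$ is the $r$-uniform hypergraph whose vertex set has $nq$ vertices partitioned into $n$ classes $V_1,\dots,V_n$ of $q$ vertices each, and in which an $r$-subset $K$ of the vertex set is an edge if and only if the multiset of non-zero cardinalities $|K\cap V_i|$, $1\le i\le n$, is exactly the partition $\sigma$. $s(\sigma)$ denotes the number of parts of $\sigma$ and $\delta$ its smallest part. A $(2,\beta)$-colouring is an assignment of colours to the vertices such that every edge contains at least $2$ and at most $\beta$ distinct colours. -}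

module Defs where

open import Data.Nat using (ℕ; _≤_; _≟_)
open import Data.Bool using (Bool; true; false; if_then_else_)
open import Data.Fin using (Fin)
open import Data.Fin.Subset using (Subset; ∣_∣)
open import Data.Vec using (lookup)
open import Data.Nat.ListAction using (sum)
open import Data.List using (List; []; _∷_; length; filter; allFin; map; concatMap; deduplicate)
open import Data.List.Relation.Unary.All using (All)
open import Data.List.Membership.Propositional using (_∈_)
open import Data.List.Relation.Binary.Permutation.Propositional using (_↭_)
open import Relation.Nullary using (¬?; does)
open import Relation.Binary.PropositionalEquality using (_≡_; _≢_)
import Data.Fin as F

-- A partition σ of r : a list (multiset, order irrelevant) of positive parts summing to r.
IsPartition : ℕ → List ℕ → Set
IsPartition r σ = All (λ k → 1 ≤ k) σ Data.Product.× (sum σ ≡ r)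
  where import Data.Product

s : List ℕ → ℕ
s = length

IsSmallestPart : ℕ → List ℕ → Set
IsSmallestPart δ σ = (δ ∈ σ) Data.Product.× All (δ ≤_) σ
  where import Data.Product

-- Vertices of H(n,r,q|σ) are pairs (i , j) with i : Fin n the class index and
-- j : Fin q the position inside the class V_i.
-- A vertex subset K is given class-by-class: K i ⊆ V_i.
VSubset : ℕ → ℕ → Set
VSubset n q = Fin n → Subset q

nonzeroCards : ∀ {n q} → VSubset n q → List ℕ
nonzeroCards {n} K = filter (λ k → ¬? (k ≟ 0)) (map (λ i → ∣ K i ∣) (allFin n))

-- K is an edge of H(n,r,q|σ).  (|K| = r follows automatically since σ sums to r.)
IsEdge : (n r q : ℕ) (σ : List ℕ) → VSubset n q → Set
IsEdge n r q σ K = nonzeroCards K ↭ σ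

Colouring : ℕ → ℕ → Set
Colouring n q = Fin n → Fin q → ℕ

coloursOn : ∀ {n q} → Colouring n q → VSubset n q → List ℕ
coloursOn {n} {q} c K =
  concatMap (λ i → concatMap (λ j → if lookup (K i) j then c i j ∷ [] else []) (allFin q)) (allFin n)

numColours : ∀ {n q} → Colouring n q → VSubset n q → ℕ
numColours c K = length (deduplicate _≟_ (coloursOn c K))

Is2βColouring : (n r q : ℕ) (σ : List ℕ) (β : ℕ) → Colouring n q → Set
Is2βColouring n r q σ β c =
  ∀ (K : VSubset n q) → IsEdge n r q σ K → (2 ≤ numColours c K) Data.Product.× (numColours c K ≤ β)
  where import Data.Product

recolour : ∀ {n q} → Colouring n q → Fin n → ℕ → Colouring n q
recolour c V z i j = if does (i F.≟ V) then z else c i j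

-- Let K be an edge. If K misses the class V, recolouring does not touch K. Otherwise
-- k = |K ∩ V| is a part of σ, so δ ≤ k, and k < r because σ has at least two positive
-- parts. After recolouring, K ∩ V shows only the fresh colour z while the r − k ≥ 1
-- vertices of K outside V keep old colours, all different from z. Hence K has at least
-- two colours and at most 1 + (r − k) ≤ 1 + r − δ ≤ β.

module Submission where

open import Defs
open import Data.Nat using (ℕ; _≤_; _+_)
open import Data.Fin using (Fin)
open import Data.List using (List)
open import Relation.Binary.PropositionalEquality using (_≢_)

open import Data.Nat using (zero; suc; _<_; z≤n; s≤s; _≟_)
open import Data.Nat.Properties
  using (≤-trans; ≤-reflexive; +-mono-≤; +-monoˡ-≤; +-comm; +-assoc; m≤m+n; m≤n+m; m<m+n; n≢0⇒n>0; +-cancelʳ-≤; +-cancelʳ-<; module ≤-Reasoning)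
open import Data.Nat.ListAction using (sum)
open import Data.Nat.ListAction.Properties using (sum-↭)
open import Data.Bool using (true; false; if_then_else_)
import Data.Fin as F
open import Data.Fin.Subset using (Subset; ∣_∣)
open import Data.Vec using ([]; _∷_; lookup)
open import Data.List using ([]; _∷_; _++_; length; filter; map; concat; concatMap; allFin; deduplicate)
open import Data.List.Properties using (length-filter; filter-++; length-++; filter-none; map-tabulate; concatMap-cong)
open import Data.List.Relation.Unary.All as All using (All; []; _∷_)
open import Data.List.Relation.Unary.Any using (here; there)
open import Data.List.Relation.Unary.Any.Properties using (deduplicate⁺)
open import Data.List.Membership.Propositional using (_∈_; lose)
open import Data.List.Membership.Propositional.Properties using (∈-allFin; ∈-map⁺; ∈-filter⁺; ∈-concatMap⁺)
open import Data.List.Relation.Binary.Sublist.Propositional using (_⊆_; []; _∷_; ⊆-trans)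
open import Data.List.Relation.Binary.Sublist.Propositional.Properties using (filter-⊆; filter⁺; length-mono-≤)
open import Data.List.Relation.Binary.Permutation.Propositional.Properties using (∈-resp-↭)
open import Data.Product using (∃; _×_; _,_)
open import Data.Empty using (⊥-elim)
open import Function using (_∘_; id)
open import Relation.Binary.Definitions using (DecidableEquality)
open import Relation.Binary.PropositionalEquality using (_≡_; refl; sym; trans; cong; subst; module ≡-Reasoning)
open import Relation.Nullary using (yes; no; ¬?; does)

module _ {A : Set} (_≟_ : DecidableEquality A) where

  deleteAll : A → List A → List A
  deleteAll z = filter (λ x → ¬? (x ≟ z))

  deleteAll-All≡ : ∀ {z xs} → All (_≡ z) xs → deleteAll z xs ≡ []
  deleteAll-All≡ = filter-none _ ∘ All.map (λ x≡z x≢z → x≢z x≡z)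

  length-deleteAll-concatMap≤ : ∀ {B : Set} z (G : B → List A) (h : B → ℕ) →
    (∀ b → length (deleteAll z (G b)) ≤ h b) →
    ∀ bs → length (deleteAll z (concatMap G bs)) ≤ sum (map h bs)
  length-deleteAll-concatMap≤ z G h G≤h []       = z≤n
  length-deleteAll-concatMap≤ z G h G≤h (b ∷ bs) = begin
    length (deleteAll z (G b ++ concatMap G bs))
      ≡⟨ cong length (filter-++ _ (G b) (concatMap G bs)) ⟩
    length (deleteAll z (G b) ++ deleteAll z (concatMap G bs))
      ≡⟨ length-++ (deleteAll z (G b)) ⟩
    length (deleteAll z (G b)) + length (deleteAll z (concatMap G bs))
      ≤⟨ +-mono-≤ (G≤h b) (length-deleteAll-concatMap≤ z G h G≤h bs) ⟩
    h b + sum (map h bs) ∎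
    where open ≤-Reasoning

  deduplicate-⊆ : ∀ xs → deduplicate _≟_ xs ⊆ xs
  deduplicate-⊆ []       = []
  deduplicate-⊆ (x ∷ xs) = refl ∷ ⊆-trans (filter-⊆ _ (deduplicate _≟_ xs)) (deduplicate-⊆ xs)

  length-deduplicate≤1+length-deleteAll : ∀ z xs →
    length (deduplicate _≟_ xs) ≤ suc (length (deleteAll z xs))
  length-deduplicate≤1+length-deleteAll z []       = z≤n
  length-deduplicate≤1+length-deleteAll z (x ∷ xs) with x ≟ z
  ... | yes refl = s≤s (length-mono-≤ (filter⁺ _ _ (λ { refl z≢y y≡z → z≢y (sym y≡z) }) (deduplicate-⊆ xs)))
  ... | no _     = s≤s (≤-trans (length-filter (λ y → ¬? (x ≟ y)) (deduplicate _≟_ xs))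
                                (length-deduplicate≤1+length-deleteAll z xs))

  2≤length-deduplicate : ∀ {x y xs} → x ∈ xs → y ∈ xs → x ≢ y → 2 ≤ length (deduplicate _≟_ xs)
  2≤length-deduplicate {x} {y} x∈ y∈ x≢y = 2≤length (∈-deduplicate x∈) (∈-deduplicate y∈)
    where
    ∈-deduplicate : ∀ {w ws} → w ∈ ws → w ∈ deduplicate _≟_ ws
    ∈-deduplicate = deduplicate⁺ _≟_ (λ u≡v w≡u → trans w≡u (sym u≡v))
    2≤length : ∀ {ys} → x ∈ ys → y ∈ ys → 2 ≤ length ys
    2≤length {_ ∷ _ ∷ _} _ _ = s≤s (s≤s z≤n)
    2≤length {_ ∷ []} (here refl) (here refl) = ⊥-elim (x≢y refl)
    2≤length {_ ∷ []} (here _)    (there ())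
    2≤length {_ ∷ []} (there ())  _

sum-filter-nonzero : ∀ ks → sum (filter (λ k → ¬? (k ≟ 0)) ks) ≡ sum ks
sum-filter-nonzero []         = refl
sum-filter-nonzero (zero ∷ ks)  = sum-filter-nonzero ks
sum-filter-nonzero (suc k ∷ ks) = cong (suc k +_) (sum-filter-nonzero ks)

∈⇒≤sum : ∀ {k ks} → k ∈ ks → k ≤ sum ks
∈⇒≤sum {ks = k ∷ ks} (here refl) = m≤m+n k (sum ks)
∈⇒≤sum {ks = l ∷ ks} (there k∈) = ≤-trans (∈⇒≤sum k∈) (m≤n+m (sum ks) l)

∈⇒<sum : ∀ {k ks} → All (1 ≤_) ks → 2 ≤ length ks → k ∈ ks → k < sum ks
∈⇒<sum {ks = _ ∷ []} _ (s≤s ()) _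
∈⇒<sum {ks = k ∷ l ∷ ks} (_ ∷ 1≤l ∷ _) _ (here refl) = m<m+n k (≤-trans 1≤l (m≤m+n l (sum ks)))
∈⇒<sum {ks = _ ∷ l ∷ ks} (1≤k ∷ _) _ (there k∈) = +-mono-≤ 1≤k (∈⇒≤sum k∈)

1≤sum⇒∃ : ∀ {B : Set} (h : B → ℕ) bs → 1 ≤ sum (map h bs) → ∃ λ b → 1 ≤ h b
1≤sum⇒∃ h (b ∷ bs) 1≤Σ with h b in hb≡
... | suc _ = b , subst (1 ≤_) (sym hb≡) (s≤s z≤n)
... | zero  = 1≤sum⇒∃ h bs 1≤Σ

map-allFin-suc : ∀ {B : Set} {n} (f : Fin (suc n) → B) →
  map f (allFin (suc n)) ≡ f F.zero ∷ map (f ∘ F.suc) (allFin n)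
map-allFin-suc f = cong (f F.zero ∷_) (trans (map-tabulate F.suc f) (sym (map-tabulate id (f ∘ F.suc))))

sum-allFin-except : ∀ {n} (f : Fin n → ℕ) V →
  sum (map (λ i → if does (i F.≟ V) then 0 else f i) (allFin n)) + f V ≡ sum (map f (allFin n))
sum-allFin-except {suc n} f F.zero = begin
  sum (map (λ i → if does (i F.≟ F.zero) then 0 else f i) (allFin (suc n))) + f F.zero
    ≡⟨ cong (λ ks → sum ks + f F.zero) (map-allFin-suc (λ i → if does (i F.≟ F.zero) then 0 else f i)) ⟩
  sum (map (f ∘ F.suc) (allFin n)) + f F.zero
    ≡⟨ +-comm (sum (map (f ∘ F.suc) (allFin n))) (f F.zero) ⟩
  sum (f F.zero ∷ map (f ∘ F.suc) (allFin n))
    ≡⟨ cong sum (map-allFin-suc f) ⟨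
  sum (map f (allFin (suc n))) ∎
  where open ≡-Reasoning
sum-allFin-except {suc n} f (F.suc V) = begin
  sum (map (λ i → if does (i F.≟ F.suc V) then 0 else f i) (allFin (suc n))) + f (F.suc V)
    ≡⟨ cong (λ ks → sum ks + f (F.suc V)) (map-allFin-suc (λ i → if does (i F.≟ F.suc V) then 0 else f i)) ⟩
  f F.zero + sum (map (λ i → if does (i F.≟ V) then 0 else f (F.suc i)) (allFin n)) + f (F.suc V)
    ≡⟨ +-assoc (f F.zero) _ (f (F.suc V)) ⟩
  f F.zero + (sum (map (λ i → if does (i F.≟ V) then 0 else f (F.suc i)) (allFin n)) + f (F.suc V))
    ≡⟨ cong (f F.zero +_) (sum-allFin-except (f ∘ F.suc) V) ⟩
  sum (f F.zero ∷ map (f ∘ F.suc) (allFin n))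
    ≡⟨ cong sum (map-allFin-suc f) ⟨
  sum (map f (allFin (suc n))) ∎
  where open ≡-Reasoning

coloursIn : ∀ {q} → Subset q → (Fin q → ℕ) → List ℕ
coloursIn []          f = []
coloursIn (true ∷ p)  f = f F.zero ∷ coloursIn p (f ∘ F.suc)
coloursIn (false ∷ p) f = coloursIn p (f ∘ F.suc)

concatMap-lookup≡coloursIn : ∀ {q} (p : Subset q) f →
  concatMap (λ j → if lookup p j then f j ∷ [] else []) (allFin q) ≡ coloursIn p f
concatMap-lookup≡coloursIn []          f = refl
concatMap-lookup≡coloursIn (true ∷ p) f =
  trans (cong concat (map-allFin-suc (λ j → if lookup (true ∷ p) j then f j ∷ [] else [])))
        (cong (f F.zero ∷_) (concatMap-lookup≡coloursIn p (f ∘ F.suc)))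
concatMap-lookup≡coloursIn (false ∷ p) f =
  trans (cong concat (map-allFin-suc (λ j → if lookup (false ∷ p) j then f j ∷ [] else [])))
        (concatMap-lookup≡coloursIn p (f ∘ F.suc))

coloursOn≡concatMap-coloursIn : ∀ {n q} (c : Colouring n q) K →
  coloursOn c K ≡ concatMap (λ i → coloursIn (K i) (c i)) (allFin n)
coloursOn≡concatMap-coloursIn {n} c K = concatMap-cong (λ i → concatMap-lookup≡coloursIn (K i) (c i)) (allFin n)

length-coloursIn : ∀ {q} (p : Subset q) f → length (coloursIn p f) ≡ ∣ p ∣
length-coloursIn []          f = refl
length-coloursIn (true ∷ p)  f = cong suc (length-coloursIn p (f ∘ F.suc))
length-coloursIn (false ∷ p) f = length-coloursIn p (f ∘ F.suc)

coloursIn-∣∣≡0 : ∀ {q} (p : Subset q) f → ∣ p ∣ ≡ 0 → coloursIn p f ≡ []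
coloursIn-∣∣≡0 []          f _ = refl
coloursIn-∣∣≡0 (false ∷ p) f ∣p∣≡0 = coloursIn-∣∣≡0 p (f ∘ F.suc) ∣p∣≡0

coloursIn-const : ∀ {q} (p : Subset q) {f z} → (∀ j → f j ≡ z) → All (_≡ z) (coloursIn p f)
coloursIn-const []          f≡z = []
coloursIn-const (true ∷ p)  f≡z = f≡z F.zero ∷ coloursIn-const p (f≡z ∘ F.suc)
coloursIn-const (false ∷ p) f≡z = coloursIn-const p (f≡z ∘ F.suc)

∈-coloursIn : ∀ {q} (p : Subset q) f → 1 ≤ ∣ p ∣ → ∃ λ j → f j ∈ coloursIn p f
∈-coloursIn (true ∷ p)  f _ = F.zero , here refl
∈-coloursIn (false ∷ p) f 1≤∣p∣ with ∈-coloursIn p (f ∘ F.suc) 1≤∣p∣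
... | j , fj∈ = F.suc j , fj∈

∈-coloursOn : ∀ {n q} (c : Colouring n q) K i → 1 ≤ ∣ K i ∣ → ∃ λ j → c i j ∈ coloursOn c K
∈-coloursOn c K i 1≤∣Ki∣ with ∈-coloursIn (K i) (c i) 1≤∣Ki∣
... | j , cij∈ = j , subst (c i j ∈_) (sym (coloursOn≡concatMap-coloursIn c K))
                           (∈-concatMap⁺ (λ i → coloursIn (K i) (c i)) (lose (∈-allFin i) cij∈))

recolour-inside : ∀ {n q} (c : Colouring n q) V z j → recolour c V z V j ≡ z
recolour-inside c V z j with V F.≟ V
... | yes _  = refl
... | no V≢V = ⊥-elim (V≢V refl)

recolour-outside : ∀ {n q} (c : Colouring n q) V z {i} → i ≢ V → ∀ j → recolour c V z i j ≡ c i j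
recolour-outside c V z {i} i≢V j with i F.≟ V
... | yes i≡V = ⊥-elim (i≢V i≡V)
... | no _    = refl

sum-classSizes : ∀ {n r q σ} (K : VSubset n q) → IsPartition r σ → IsEdge n r q σ K →
  sum (map (λ i → ∣ K i ∣) (allFin n)) ≡ r
sum-classSizes {n} K (_ , Σσ≡r) edge =
  trans (sym (sum-filter-nonzero (map (λ i → ∣ K i ∣) (allFin n)))) (trans (sum-↭ edge) Σσ≡r)

classSize∈σ : ∀ {n r q σ} (K : VSubset n q) → IsEdge n r q σ K → ∀ i → ∣ K i ∣ ≢ 0 → ∣ K i ∣ ∈ σ
classSize∈σ K edge i ∣Ki∣≢0 =
  ∈-resp-↭ edge (∈-filter⁺ (λ k → ¬? (k ≟ 0)) (∈-map⁺ (λ i → ∣ K i ∣) (∈-allFin i)) ∣Ki∣≢0)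

sizeOutside : ∀ {n q} → VSubset n q → Fin n → ℕ
sizeOutside {n} K V = sum (map (λ i → if does (i F.≟ V) then 0 else ∣ K i ∣) (allFin n))

sizeOutside+∣KV∣ : ∀ {n q} (K : VSubset n q) V → sizeOutside K V + ∣ K V ∣ ≡ sum (map (λ i → ∣ K i ∣) (allFin n))
sizeOutside+∣KV∣ K V = sum-allFin-except (λ i → ∣ K i ∣) V

1≤sizeOutside⇒∃ : ∀ {n q} (K : VSubset n q) V → 1 ≤ sizeOutside K V → ∃ λ i → i ≢ V × 1 ≤ ∣ K i ∣
1≤sizeOutside⇒∃ {n} K V 1≤outside with 1≤sum⇒∃ _ (allFin n) 1≤outside
... | i , 1≤hi with i F.≟ V
...   | no i≢V = i , i≢V , 1≤hi
1≤sizeOutside⇒∃ K V _ | _ , () | yes _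

numColours-recolour-emptyClass : ∀ {n q} (c : Colouring n q) K V z → ∣ K V ∣ ≡ 0 →
  numColours (recolour c V z) K ≡ numColours c K
numColours-recolour-emptyClass c K V z ∣KV∣≡0 = cong (length ∘ deduplicate _≟_) (begin
  coloursOn (recolour c V z) K
    ≡⟨ coloursOn≡concatMap-coloursIn (recolour c V z) K ⟩
  concatMap (λ i → coloursIn (K i) (recolour c V z i)) (allFin _)
    ≡⟨ concatMap-cong sameClassColours (allFin _) ⟩
  concatMap (λ i → coloursIn (K i) (c i)) (allFin _)
    ≡⟨ coloursOn≡concatMap-coloursIn c K ⟨
  coloursOn c K ∎)
  where
  open ≡-Reasoning
  sameClassColours : ∀ i → coloursIn (K i) (recolour c V z i) ≡ coloursIn (K i) (c i)
  sameClassColours i with i F.≟ V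
  ... | yes refl = trans (coloursIn-∣∣≡0 (K V) _ ∣KV∣≡0) (sym (coloursIn-∣∣≡0 (K V) _ ∣KV∣≡0))
  ... | no _     = refl

numColours-recolour≤ : ∀ {n q} (c : Colouring n q) K V z → numColours (recolour c V z) K ≤ suc (sizeOutside K V)
numColours-recolour≤ c K V z = begin
  numColours (recolour c V z) K
    ≤⟨ length-deduplicate≤1+length-deleteAll _≟_ z (coloursOn (recolour c V z) K) ⟩
  suc (length (deleteAll _≟_ z (coloursOn (recolour c V z) K)))
    ≡⟨ cong (suc ∘ length ∘ deleteAll _≟_ z) (coloursOn≡concatMap-coloursIn (recolour c V z) K) ⟩
  suc (length (deleteAll _≟_ z (concatMap (λ i → coloursIn (K i) (recolour c V z i)) (allFin _))))
    ≤⟨ s≤s (length-deleteAll-concatMap≤ _≟_ z _ _ otherColoursInClass (allFin _)) ⟩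
  suc (sizeOutside K V) ∎
  where
  open ≤-Reasoning
  otherColoursInClass : ∀ i → length (deleteAll _≟_ z (coloursIn (K i) (recolour c V z i)))
                             ≤ (if does (i F.≟ V) then 0 else ∣ K i ∣)
  otherColoursInClass i with i F.≟ V
  ... | yes refl = ≤-reflexive (cong length (deleteAll-All≡ _≟_ (coloursIn-const (K V) (λ _ → refl))))
  ... | no _     = ≤-trans (length-filter (λ x → ¬? (x ≟ z)) (coloursIn (K i) (c i)))
                           (≤-reflexive (length-coloursIn (K i) (c i)))

2≤numColours-recolour : ∀ {n q} (c : Colouring n q) K V z → (∀ i j → c i j ≢ z) →
  1 ≤ ∣ K V ∣ → 1 ≤ sizeOutside K V → 2 ≤ numColours (recolour c V z) K
2≤numColours-recolour c K V z fresh 1≤∣KV∣ 1≤outside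
  with ∈-coloursOn (recolour c V z) K V 1≤∣KV∣ | 1≤sizeOutside⇒∃ K V 1≤outside
... | j , z∈ | i , i≢V , 1≤∣Ki∣ with ∈-coloursOn (recolour c V z) K i 1≤∣Ki∣
...   | j′ , cij′∈ =
  2≤length-deduplicate _≟_ (subst (_∈ _) (recolour-inside c V z j) z∈) cij′∈
    (λ z≡ → fresh i j′ (trans (sym (recolour-outside c V z i≢V j′)) (sym z≡)))

lemma4p1 : (r : ℕ) (σ : List ℕ) (δ n q β : ℕ) →
    1 ≤ r → IsPartition r σ → IsSmallestPart δ σ →
    1 ≤ n → 1 ≤ q →
    2 ≤ s σ → s σ ≤ β → r + 1 ≤ δ + β →
    (c : Colouring n q) → Is2βColouring n r q σ β c →
    (V : Fin n) (z : ℕ) → (∀ i j → c i j ≢ z) →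
    Is2βColouring n r q σ β (recolour c V z)
lemma4p1 r σ δ n q β _ partition@(parts≥1 , Σσ≡r) (_ , δ≤parts) _ _ 2≤s _ r+1≤δ+β c c-ok V z fresh K edge
  with ∣ K V ∣ ≟ 0
... | yes ∣KV∣≡0 = subst (λ m → 2 ≤ m × m ≤ β) (sym (numColours-recolour-emptyClass c K V z ∣KV∣≡0)) (c-ok K edge)
... | no ∣KV∣≢0 =
  2≤numColours-recolour c K V z fresh (n≢0⇒n>0 ∣KV∣≢0) 1≤outside ,
  ≤-trans (numColours-recolour≤ c K V z) 1+outside≤β
  where
  open ≤-Reasoning
  ∣KV∣∈σ : ∣ K V ∣ ∈ σ
  ∣KV∣∈σ = classSize∈σ {r = r} K edge V ∣KV∣≢0
  outside+∣KV∣≡r : sizeOutside K V + ∣ K V ∣ ≡ r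
  outside+∣KV∣≡r = trans (sizeOutside+∣KV∣ K V) (sum-classSizes K partition edge)
  1≤outside : 1 ≤ sizeOutside K V
  1≤outside = +-cancelʳ-< ∣ K V ∣ 0 (sizeOutside K V) (begin-strict
    ∣ K V ∣                   <⟨ ∈⇒<sum parts≥1 2≤s ∣KV∣∈σ ⟩
    sum σ                     ≡⟨ trans Σσ≡r (sym outside+∣KV∣≡r) ⟩
    sizeOutside K V + ∣ K V ∣ ∎)
  1+outside≤β : suc (sizeOutside K V) ≤ β
  1+outside≤β = +-cancelʳ-≤ ∣ K V ∣ (suc (sizeOutside K V)) β (begin
    suc (sizeOutside K V + ∣ K V ∣) ≡⟨ cong suc outside+∣KV∣≡r ⟩
    suc r                           ≡⟨ +-comm 1 r ⟩
    r + 1                           ≤⟨ r+1≤δ+β ⟩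
    δ + β                           ≤⟨ +-monoˡ-≤ β (All.lookup δ≤parts ∣KV∣∈σ) ⟩
    ∣ K V ∣ + β                     ≡⟨ +-comm ∣ K V ∣ β ⟩
    β + ∣ K V ∣                     ∎)
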